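{- For any integer $k\geq 2$, $gr_{k}^{*}(K_{3}: C_{4})=k+3$.
   Context: All graphs are finite and simple; $C_4$ is the cycle on 4 vertices. A $k$-edge-coloring uses colors from $[k]=\{1,\ldots,k\}$. A subgraph is monochromatic if all its edges have the same color and rainbow if no two of its edges have the same color. The Gallai-Ramsey number $gr_k(K_3: H)$ is the smallest integer $n$ such that every $k$-edge-colored $K_n$ contains either a rainbow $K_3$ or a monochromatic copy of $H$. For $n=gr_k(K_3:H)$ and $0\le s\le n-1$, $K_{n-1}\sqcup K_{1,s}$ denotes the graph obtained from $K_{n-1}$ by adding a new vertex $v$ and $s$ edges joining $v$ to $s$ vertices of $K_{n-1}$. The star-critical Gallai-Ramsey number $gr_k^{*}(K_3: H)$ is the smallest integer $s$ such that every $k$-edge-colored $K_{n-1}\sqcup K_{1,s}$ contains either a rainbow $K_3$ or a monochromatic copy of $H$. (It is known that $gr_k(K_3:C_4)=k+4$ for $k\ge 2$.) -}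

module Defs where

open import Data.Nat using (ℕ; suc; _+_; _<_)
open import Data.Fin using (Fin; zero; suc)
open import Data.Fin.Subset using (Subset; _∈_; ∣_∣)
open import Data.Product using (Σ; ∃; _×_)
open import Data.Sum using (_⊎_)
open import Data.Empty using (⊥)
open import Relation.Nullary using (¬_)
open import Relation.Binary.PropositionalEquality using (_≡_; _≢_)

-- The graph K_m ⊔ K_{1,s}: vertex set Fin (suc m); vertex `zero` is the
-- extra vertex v, vertices `suc i` (i : Fin m) form the clique K_m, and
-- v is joined exactly to the vertices `suc i` with i ∈ S.
Edge : {m : ℕ} → Subset m → Fin (suc m) → Fin (suc m) → Set
Edge S zero    zero    = ⊥
Edge S zero    (suc j) = j ∈ S
Edge S (suc i) zero    = i ∈ S
Edge S (suc i) (suc j) = i ≢ j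

-- A k-edge-colouring: a symmetric colour assignment to pairs of vertices
-- (only its values on edges of the graph are ever used).
Colouring : ℕ → ℕ → Set
Colouring k N = Σ (Fin N → Fin N → Fin k) λ c → ∀ x y → c x y ≡ c y x

RainbowK3 : {k N : ℕ} → (Fin N → Fin N → Set) → (Fin N → Fin N → Fin k) → Set
RainbowK3 {N = N} E c =
  Σ (Fin N) λ x → Σ (Fin N) λ y → Σ (Fin N) λ z →
    E x y × E y z × E x z ×
    c x y ≢ c y z × c y z ≢ c x z × c x y ≢ c x z

MonoC4 : {k N : ℕ} → (Fin N → Fin N → Set) → (Fin N → Fin N → Fin k) → Set
MonoC4 {k} {N} E c =
  Σ (Fin N) λ a → Σ (Fin N) λ b → Σ (Fin N) λ d → Σ (Fin N) λ e →
    a ≢ b × a ≢ d × a ≢ e × b ≢ d × b ≢ e × d ≢ e ×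
    E a b × E b d × E d e × E e a ×
    Σ (Fin k) λ i → c a b ≡ i × c b d ≡ i × c d e ≡ i × c e a ≡ i

StarGood : (k m s : ℕ) → Set
StarGood k m s =
  (S : Subset m) → ∣ S ∣ ≡ s → (col : Colouring k (suc m)) →
  RainbowK3 (Edge S) (Σ.proj₁ col) ⊎ MonoC4 (Edge S) (Σ.proj₁ col)

-- gr*_k(K_3 : C_4) = t, where n = gr_k(K_3 : C_4) = k + 4, so n - 1 = k + 3:
-- t is the least s with StarGood k (k + 3) s.
StarCriticalGR-K3-C4 : ℕ → ℕ → Set
StarCriticalGR-K3-C4 k t =
  StarGood k (k + 3) t × (∀ s → s < t → ¬ StarGood k (k + 3) s)

-- In a Gallai colouring of K_n (n ≥ 6) without monochromatic C₄ some vertex is a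
-- monochromatic star. On K₆ a monochromatic claw (K₁,₃) exists and grows into a star; for larger n
-- a star of K_{n-1} is a star of K_n except for one edge, which is repaired by moving the centre.
-- Deleting the centre of a star leaves its colour a matching, and merging it into a colour that is
-- already a matching removes one colour and one vertex. So with k + 1 colours, colour 0 a matching,
-- there are at most k + 3 vertices, and every k-colouring of K_{k+4} = K_{k+3} ⊔ K₁,ₖ₊₃ has a
-- rainbow K₃ or a monochromatic C₄. A 2-colouring of K₆ minus an edge without monochromatic C₄, extended by k - 2 vertices
-- each sending a new colour of its own to all later vertices, colours K_{k+4} minus an edge, which
-- contains K_{k+3} ⊔ K₁,ₛ for every s < k + 3.

module Submission where

open import Defs
open import Data.Nat using (ℕ; _≤_; _+_)

open import Data.Nat as ℕ using (zero; suc; _<_; _<?_; s≤s; z≤n)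
open import Data.Nat.Properties using (<⇒≱; 1+n≰n; +-comm; ≤-reflexive)
open import Data.Fin using (Fin; zero; suc; punchIn; punchOut; splitAt; join; _↑ˡ_; _↑ʳ_)
open import Data.Fin.Patterns using (0F; 1F; 2F; 3F; 4F; 5F)
open import Data.Fin.Properties
  using (_≟_; any?; all?; injective⇒≤; suc-injective; punchIn-injective; punchInᵢ≢i; punchOut-injective;
         join-splitAt; splitAt-join)
open import Data.Fin.Subset using (Subset; ⊤; inside; outside; ∣_∣)
open import Data.Fin.Subset.Properties using (_∈?_; ∈⊤; ∣p∣≡n⇒p≡⊤)
open import Data.List using (List; []; _∷_; length; lookup)
open import Data.List.Membership.Propositional using (_∈_)
open import Data.List.Membership.Propositional.Properties using (∈-lookup)
open import Data.List.Membership.Setoid.Properties using (index-injective)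
open import Data.List.Relation.Unary.All as All using (All; []; _∷_)
open import Data.List.Relation.Unary.All.Properties using (¬Any⇒All¬)
open import Data.List.Relation.Unary.AllPairs using (allPairs?)
open import Data.List.Relation.Unary.Any as Any using (index)
open import Data.List.Relation.Unary.Unique.Propositional using (Unique; []; _∷_)
open import Data.Vec as Vec using (Vec; []; _∷_; there)
open import Data.Product using (Σ; ∃-syntax; _×_; _,_)
open import Data.Sum as Sum using (_⊎_; inj₁; inj₂; [_,_]′)
open import Data.Sum.Properties using (inj₁-injective)
open import Data.Empty using (⊥; ⊥-elim)
open import Function using (_∘_)
open import Function.Definitions using (Injective)
open import Relation.Nullary using (¬_; Dec; yes; no; contradiction)
open import Relation.Nullary.Decidable using (True; toWitness; ¬?; _×-dec_; decidable-stable; from-yes; from-no)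
open import Relation.Binary.PropositionalEquality
  using (_≡_; _≢_; refl; sym; trans; cong; subst; subst₂; setoid; ≢-sym)

fresh : ∀ {N} (xs : List (Fin N)) → {True (length xs <? N)} → ∃[ y ] All (y ≢_) xs
fresh {N} xs {xs<N} with any? (λ y → ¬? (Any.any? (y ≟_) xs))
... | yes (y , y∉xs) = y , ¬Any⇒All¬ xs y∉xs
... | no ¬fresh = contradiction (injective⇒≤ position-injective) (<⇒≱ (toWitness xs<N))
  where
  member : ∀ y → y ∈ xs
  member y = decidable-stable (Any.any? (y ≟_) xs) λ y∉xs → ¬fresh (y , y∉xs)
  position-injective : Injective _≡_ _≡_ (λ y → index (member y))
  position-injective = index-injective (setoid (Fin N)) (member _) (member _)

lookup-injective : ∀ {A : Set} {xs : List A} → Unique xs → Injective _≡_ _≡_ (lookup xs)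
lookup-injective (_ ∷ _)  {zero}  {zero}  _  = refl
lookup-injective (x≢ ∷ _) {zero}  {suc j} eq = contradiction eq (All.lookup x≢ (∈-lookup j))
lookup-injective (x≢ ∷ _) {suc i} {zero}  eq = contradiction (sym eq) (All.lookup x≢ (∈-lookup i))
lookup-injective (_ ∷ u)  {suc i} {suc j} eq = cong suc (lookup-injective u eq)

unique-length≤ : ∀ {N} {xs : List (Fin N)} → Unique xs → length xs ≤ N
unique-length≤ u = injective⇒≤ (lookup-injective u)

distinct : ∀ {n} (xs : List (Fin n)) → {True (allPairs? (λ x y → ¬? (x ≟ y)) xs)} → Unique xs
distinct xs {xs-distinct} = toWitness xs-distinct

≢-resp : ∀ {A : Set} {p q j k : A} → p ≡ j → q ≡ k → j ≢ k → p ≢ q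
≢-resp refl refl j≢k = j≢k

pigeonhole-3→2 : ∀ {A : Set} {i j p q r : A} → p ≡ i ⊎ p ≡ j → q ≡ i ⊎ q ≡ j → r ≡ i ⊎ r ≡ j →
                 p ≢ q → p ≢ r → q ≢ r → ⊥
pigeonhole-3→2 (inj₁ refl) (inj₁ refl) _          p≢q _   _   = p≢q refl
pigeonhole-3→2 (inj₂ refl) (inj₂ refl) _          p≢q _   _   = p≢q refl
pigeonhole-3→2 (inj₁ refl) (inj₂ refl) (inj₁ refl) _  p≢r _   = p≢r refl
pigeonhole-3→2 (inj₁ refl) (inj₂ refl) (inj₂ refl) _  _   q≢r = q≢r refl
pigeonhole-3→2 (inj₂ refl) (inj₁ refl) (inj₁ refl) _  _   q≢r = q≢r refl
pigeonhole-3→2 (inj₂ refl) (inj₁ refl) (inj₂ refl) _  p≢r _   = p≢r refl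

-- Gallai colourings without monochromatic C₄

Gallai : ∀ {N K} → (Fin N → Fin N → Fin K) → Set
Gallai {N} c = ∀ (x y z : Fin N) → x ≢ y → y ≢ z → x ≢ z →
  c x y ≡ c y z ⊎ c y z ≡ c x z ⊎ c x y ≡ c x z

C4Free : ∀ {N K} → (Fin N → Fin N → Fin K) → Set
C4Free {N} {K} c = ∀ (a b d e : Fin N) (i : Fin K) →
  a ≢ b → a ≢ d → a ≢ e → b ≢ d → b ≢ e → d ≢ e →
  c a b ≡ i → c b d ≡ i → c d e ≡ i → c e a ≡ i → ⊥

MonoStar : ∀ {N K} → (Fin N → Fin N → Fin K) → Set
MonoStar {N} {K} c = Σ (Fin N) λ v → Σ (Fin K) λ i → ∀ w → w ≢ v → c v w ≡ i

MonoClaw : ∀ {N K} → (Fin N → Fin N → Fin K) → Set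
MonoClaw {N} {K} c = Σ (Fin N) λ w → Σ (Fin N) λ a₁ → Σ (Fin N) λ a₂ → Σ (Fin N) λ a₃ → Σ (Fin K) λ i →
  Unique (w ∷ a₁ ∷ a₂ ∷ a₃ ∷ []) × c w a₁ ≡ i × c w a₂ ≡ i × c w a₃ ≡ i

module _ {N K} {c : Fin N → Fin N → Fin K} where

  third-colour : Gallai c → ∀ {x y z p q} → x ≢ y → y ≢ z → x ≢ z →
                 c x y ≡ p → c x z ≡ q → p ≢ q → c y z ≡ p ⊎ c y z ≡ q
  third-colour gallai {x} {y} {z} x≢y y≢z x≢z refl refl p≢q with gallai x y z x≢y y≢z x≢z
  ... | inj₁ xy≡yz        = inj₁ (sym xy≡yz)
  ... | inj₂ (inj₁ yz≡xz) = inj₂ yz≡xz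
  ... | inj₂ (inj₂ xy≡xz) = contradiction xy≡xz p≢q

  no-rainbow : Gallai c → ∀ {x y z} → x ≢ y → y ≢ z → x ≢ z →
               c x y ≢ c y z → c y z ≢ c x z → c x y ≢ c x z → ⊥
  no-rainbow gallai {x} {y} {z} x≢y y≢z x≢z n₁ n₂ n₃ with gallai x y z x≢y y≢z x≢z
  ... | inj₁ e        = n₁ e
  ... | inj₂ (inj₁ e) = n₂ e
  ... | inj₂ (inj₂ e) = n₃ e

  ≢-of-colours : ∀ {w x y p} → c w x ≡ p → c w y ≢ p → x ≢ y
  ≢-of-colours wx≡p wy≢p refl = wy≢p wx≡p

gallai-map : ∀ {N K K′} {c : Fin N → Fin N → Fin K} (f : Fin K → Fin K′) → Gallai c → Gallai (λ x y → f (c x y))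
gallai-map f gallai x y z x≢y y≢z x≢z =
  Sum.map (cong f) (Sum.map (cong f) (cong f)) (gallai x y z x≢y y≢z x≢z)

module _ {m n K} {ι : Fin m → Fin n} (ι-injective : Injective _≡_ _≡_ ι) {c : Fin n → Fin n → Fin K} where

  private
    ι-≢ : ∀ {x y} → x ≢ y → ι x ≢ ι y
    ι-≢ x≢y = x≢y ∘ ι-injective

  gallai-∘ : Gallai c → Gallai (λ x y → c (ι x) (ι y))
  gallai-∘ gallai x y z x≢y y≢z x≢z = gallai (ι x) (ι y) (ι z) (ι-≢ x≢y) (ι-≢ y≢z) (ι-≢ x≢z)

  c4Free-∘ : C4Free c → C4Free (λ x y → c (ι x) (ι y))
  c4Free-∘ c4-free a b d e i a≢b a≢d a≢e b≢d b≢e d≢e =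
    c4-free (ι a) (ι b) (ι d) (ι e) i (ι-≢ a≢b) (ι-≢ a≢d) (ι-≢ a≢e) (ι-≢ b≢d) (ι-≢ b≢e) (ι-≢ d≢e)

-- Monochromatic stars

module MonoStars {d K} (c : Fin (6 + d) → Fin (6 + d) → Fin K) (c-sym : ∀ x y → c x y ≡ c y x)
                 (gallai : Gallai c) (c4-free : C4Free c) where

  StarExcept : Fin (6 + d) → Fin (6 + d) → Fin K → Set
  StarExcept v u i = ∀ w → w ≢ v → w ≢ u → c v w ≡ i

  -- every w outside {u, v, x} sees x in colour i or c v u, no two of them alike,
  -- so three such w cannot exist
  module SecondEdge {u v x i} (u≢v : u ≢ v) (star : StarExcept v u i) (vu≢i : c v u ≢ i)
                    (x≢u : x ≢ u) (x≢v : x ≢ v) (ux≡i : c u x ≡ i) where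

    Outside : Fin (6 + d) → Set
    Outside w = All (w ≢_) (u ∷ v ∷ x ∷ [])

    vw≡i : ∀ {w} → Outside w → c v w ≡ i
    vw≡i (w≢u ∷ w≢v ∷ _) = star _ w≢v w≢u

    -- an i-edge u w would close the i-coloured 4-cycle v x u w
    u-colour : ∀ {w} → Outside w → c u w ≡ c v u
    u-colour {w} w∉@(w≢u ∷ w≢v ∷ w≢x ∷ [])
      with third-colour gallai (≢-sym u≢v) (≢-sym w≢u) (≢-sym w≢v) refl (vw≡i w∉) vu≢i
    ... | inj₁ uw≡vu = uw≡vu
    ... | inj₂ uw≡i  = ⊥-elim (c4-free v x u w i (≢-sym x≢v) (≢-sym u≢v) (≢-sym w≢v) x≢u (≢-sym w≢x) (≢-sym w≢u)
                         (star x x≢v x≢u) (trans (c-sym x u) ux≡i) uw≡i (trans (c-sym w v) (vw≡i w∉)))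

    x-colour : ∀ {w} → Outside w → c x w ≡ i ⊎ c x w ≡ c v u
    x-colour w∉@(w≢u ∷ _ ∷ w≢x ∷ []) =
      third-colour gallai (≢-sym x≢u) (≢-sym w≢x) (≢-sym w≢u) ux≡i (u-colour w∉) (≢-sym vu≢i)

    x-distinct : ∀ {w w′} → Outside w → Outside w′ → w ≢ w′ → c x w ≢ c x w′
    x-distinct {w} {w′} w∉@(w≢u ∷ w≢v ∷ w≢x ∷ []) w′∉@(w′≢u ∷ w′≢v ∷ w′≢x ∷ []) w≢w′ xw≡xw′
      with x-colour w∉
    ... | inj₁ xw≡i  = c4-free v w x w′ i (≢-sym w≢v) (≢-sym x≢v) (≢-sym w′≢v) w≢x w≢w′ (≢-sym w′≢x)
                         (vw≡i w∉) (trans (c-sym w x) xw≡i) (trans (sym xw≡xw′) xw≡i)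
                         (trans (c-sym w′ v) (vw≡i w′∉))
    ... | inj₂ xw≡vu = c4-free u w x w′ (c v u) (≢-sym w≢u) (≢-sym x≢u) (≢-sym w′≢u) w≢x w≢w′ (≢-sym w′≢x)
                         (u-colour w∉) (trans (c-sym w x) xw≡vu) (trans (sym xw≡xw′) xw≡vu)
                         (trans (c-sym w′ u) (u-colour w′∉))

    impossible : ⊥
    impossible with fresh (u ∷ v ∷ x ∷ [])
    ... | a , a∉ with fresh (u ∷ v ∷ x ∷ a ∷ [])
    ... | b , (b≢u ∷ b≢v ∷ b≢x ∷ b≢a ∷ []) with fresh (u ∷ v ∷ x ∷ a ∷ b ∷ [])
    ... | e , (e≢u ∷ e≢v ∷ e≢x ∷ e≢a ∷ e≢b ∷ []) =
      pigeonhole-3→2 (x-colour a∉) (x-colour b∉) (x-colour e∉)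
        (x-distinct a∉ b∉ (≢-sym b≢a)) (x-distinct a∉ e∉ (≢-sym e≢a)) (x-distinct b∉ e∉ (≢-sym e≢b))
      where
      b∉ : Outside b
      b∉ = b≢u ∷ b≢v ∷ b≢x ∷ []
      e∉ : Outside e
      e∉ = e≢u ∷ e≢v ∷ e≢x ∷ []

  monoStar-of-switch : ∀ {u v i} → u ≢ v → StarExcept v u i → c v u ≢ i → MonoStar c
  monoStar-of-switch {u} {v} {i} u≢v star vu≢i
    with any? (λ x → ¬? (x ≟ u) ×-dec ¬? (x ≟ v) ×-dec (c u x ≟ i))
  ... | yes (x , x≢u , x≢v , ux≡i) = ⊥-elim (SecondEdge.impossible u≢v star vu≢i x≢u x≢v ux≡i)
  ... | no ¬i-edge = u , c v u , u-star
    where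
    u-star : ∀ w → w ≢ u → c u w ≡ c v u
    u-star w w≢u with w ≟ v
    ... | yes refl = c-sym u v
    ... | no w≢v with third-colour gallai (≢-sym u≢v) (≢-sym w≢u) (≢-sym w≢v) refl (star w w≢v w≢u) vu≢i
    ...   | inj₁ uw≡vu = uw≡vu
    ...   | inj₂ uw≡i  = contradiction (w , w≢u , w≢v , uw≡i) ¬i-edge

  monoStar-of-starExcept : ∀ {v u i} → u ≢ v → StarExcept v u i → MonoStar c
  monoStar-of-starExcept {v} {u} {i} u≢v star with c v u ≟ i
  ... | no vu≢i = monoStar-of-switch u≢v star vu≢i
  ... | yes vu≡i = v , i , v-star
    where
    v-star : ∀ w → w ≢ v → c v w ≡ i
    v-star w w≢v with w ≟ u
    ... | yes refl = vu≡i
    ... | no w≢u = star w w≢v w≢u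

module _ {N K} {c : Fin N → Fin N → Fin K} (c-sym : ∀ x y → c x y ≡ c y x) (gallai : Gallai c) where

  claw-of-distinct-colours : ∀ {v y₁ y₂ y₃} → Unique (v ∷ y₁ ∷ y₂ ∷ y₃ ∷ []) →
    c v y₁ ≢ c v y₂ → c v y₁ ≢ c v y₃ → c v y₂ ≢ c v y₃ → MonoClaw c
  claw-of-distinct-colours {v} {y₁} {y₂} {y₃}
    ((v≢y₁ ∷ v≢y₂ ∷ v≢y₃ ∷ []) ∷ (y₁≢y₂ ∷ y₁≢y₃ ∷ []) ∷ (y₂≢y₃ ∷ []) ∷ [] ∷ []) j₁≢j₂ j₁≢j₃ j₂≢j₃
    with third-colour gallai v≢y₁ y₁≢y₂ v≢y₂ refl refl j₁≢j₂
       | third-colour gallai v≢y₁ y₁≢y₃ v≢y₃ refl refl j₁≢j₃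
       | third-colour gallai v≢y₂ y₂≢y₃ v≢y₃ refl refl j₂≢j₃
  ... | inj₁ y₁y₂≡j₁ | inj₁ y₁y₃≡j₁ | _ =
    y₁ , v , y₂ , y₃ , c v y₁ ,
    ((≢-sym v≢y₁ ∷ y₁≢y₂ ∷ y₁≢y₃ ∷ []) ∷ (v≢y₂ ∷ v≢y₃ ∷ []) ∷ (y₂≢y₃ ∷ []) ∷ [] ∷ []) ,
    c-sym y₁ v , y₁y₂≡j₁ , y₁y₃≡j₁
  ... | inj₂ y₁y₂≡j₂ | _ | inj₁ y₂y₃≡j₂ =
    y₂ , v , y₁ , y₃ , c v y₂ ,
    ((≢-sym v≢y₂ ∷ ≢-sym y₁≢y₂ ∷ y₂≢y₃ ∷ []) ∷ (v≢y₁ ∷ v≢y₃ ∷ []) ∷ (y₁≢y₃ ∷ []) ∷ [] ∷ []) ,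
    c-sym y₂ v , trans (c-sym y₂ y₁) y₁y₂≡j₂ , y₂y₃≡j₂
  ... | _ | inj₂ y₁y₃≡j₃ | inj₂ y₂y₃≡j₃ =
    y₃ , v , y₁ , y₂ , c v y₃ ,
    ((≢-sym v≢y₃ ∷ ≢-sym y₁≢y₃ ∷ ≢-sym y₂≢y₃ ∷ []) ∷ (v≢y₁ ∷ v≢y₂ ∷ []) ∷ (y₁≢y₂ ∷ []) ∷ [] ∷ []) ,
    c-sym y₃ v , trans (c-sym y₃ y₁) y₁y₃≡j₃ , trans (c-sym y₃ y₂) y₂y₃≡j₃
  ... | inj₁ y₁y₂≡j₁ | inj₂ y₁y₃≡j₃ | inj₁ y₂y₃≡j₂ = ⊥-elim (
    no-rainbow gallai y₁≢y₂ y₂≢y₃ y₁≢y₃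
      (≢-resp y₁y₂≡j₁ y₂y₃≡j₂ j₁≢j₂) (≢-resp y₂y₃≡j₂ y₁y₃≡j₃ j₂≢j₃) (≢-resp y₁y₂≡j₁ y₁y₃≡j₃ j₁≢j₃))
  ... | inj₂ y₁y₂≡j₂ | inj₁ y₁y₃≡j₁ | inj₂ y₂y₃≡j₃ = ⊥-elim (
    no-rainbow gallai y₁≢y₂ y₂≢y₃ y₁≢y₃
      (≢-resp y₁y₂≡j₂ y₂y₃≡j₃ j₂≢j₃) (≢-resp y₂y₃≡j₃ y₁y₃≡j₁ (≢-sym j₁≢j₃)) (≢-resp y₁y₂≡j₂ y₁y₃≡j₁ (≢-sym j₁≢j₂)))

  claw-of-repeated-colour : ∀ {v a₁ a₂ r₁ r₂ r₃} → Unique (v ∷ a₁ ∷ a₂ ∷ r₁ ∷ r₂ ∷ r₃ ∷ []) →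
    c v a₁ ≡ c v a₂ → MonoClaw c
  claw-of-repeated-colour {v} {a₁} {a₂} {r₁} {r₂} {r₃}
    ((v≢a₁ ∷ v≢a₂ ∷ v≢r₁ ∷ v≢r₂ ∷ v≢r₃ ∷ []) ∷ (a₁≢a₂ ∷ a₁≢r₁ ∷ a₁≢r₂ ∷ a₁≢r₃ ∷ []) ∷
     (a₂≢r₁ ∷ a₂≢r₂ ∷ a₂≢r₃ ∷ []) ∷ (r₁≢r₂ ∷ r₁≢r₃ ∷ []) ∷ (r₂≢r₃ ∷ []) ∷ [] ∷ []) va₁≡va₂
    with c v r₁ ≟ c v a₁ | c v r₂ ≟ c v a₁ | c v r₃ ≟ c v a₁
  ... | yes vr₁≡va₁ | _ | _ =
    v , a₁ , a₂ , r₁ , c v a₁ ,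
    ((v≢a₁ ∷ v≢a₂ ∷ v≢r₁ ∷ []) ∷ (a₁≢a₂ ∷ a₁≢r₁ ∷ []) ∷ (a₂≢r₁ ∷ []) ∷ [] ∷ []) ,
    refl , sym va₁≡va₂ , vr₁≡va₁
  ... | no _ | yes vr₂≡va₁ | _ =
    v , a₁ , a₂ , r₂ , c v a₁ ,
    ((v≢a₁ ∷ v≢a₂ ∷ v≢r₂ ∷ []) ∷ (a₁≢a₂ ∷ a₁≢r₂ ∷ []) ∷ (a₂≢r₂ ∷ []) ∷ [] ∷ []) ,
    refl , sym va₁≡va₂ , vr₂≡va₁
  ... | no _ | no _ | yes vr₃≡va₁ =
    v , a₁ , a₂ , r₃ , c v a₁ ,
    ((v≢a₁ ∷ v≢a₂ ∷ v≢r₃ ∷ []) ∷ (a₁≢a₂ ∷ a₁≢r₃ ∷ []) ∷ (a₂≢r₃ ∷ []) ∷ [] ∷ []) ,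
    refl , sym va₁≡va₂ , vr₃≡va₁
  ... | no vr₁≢va₁ | no vr₂≢va₁ | no vr₃≢va₁ with c v r₁ ≟ c v r₂ | c v r₁ ≟ c v r₃
  ... | no vr₁≢vr₂ | _ =
    claw-of-distinct-colours ((v≢a₁ ∷ v≢r₁ ∷ v≢r₂ ∷ []) ∷ (a₁≢r₁ ∷ a₁≢r₂ ∷ []) ∷ (r₁≢r₂ ∷ []) ∷ [] ∷ [])
      (≢-sym vr₁≢va₁) (≢-sym vr₂≢va₁) vr₁≢vr₂
  ... | yes _ | no vr₁≢vr₃ =
    claw-of-distinct-colours ((v≢a₁ ∷ v≢r₁ ∷ v≢r₃ ∷ []) ∷ (a₁≢r₁ ∷ a₁≢r₃ ∷ []) ∷ (r₁≢r₃ ∷ []) ∷ [] ∷ [])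
      (≢-sym vr₁≢va₁) (≢-sym vr₃≢va₁) vr₁≢vr₃
  ... | yes vr₁≡vr₂ | yes vr₁≡vr₃ =
    v , r₁ , r₂ , r₃ , c v r₁ ,
    ((v≢r₁ ∷ v≢r₂ ∷ v≢r₃ ∷ []) ∷ (r₁≢r₂ ∷ r₁≢r₃ ∷ []) ∷ (r₂≢r₃ ∷ []) ∷ [] ∷ []) ,
    refl , sym vr₁≡vr₂ , sym vr₁≡vr₃

module K6 {K} (c : Fin 6 → Fin 6 → Fin K) (c-sym : ∀ x y → c x y ≡ c y x)
          (gallai : Gallai c) (c4-free : C4Free c) where

  open MonoStars c c-sym gallai c4-free

  claw : MonoClaw c
  claw with c 0F 1F ≟ c 0F 2F | c 0F 1F ≟ c 0F 3F | c 0F 2F ≟ c 0F 3F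
  ... | yes e | _ | _ =
    claw-of-repeated-colour c-sym gallai (distinct (0F ∷ 1F ∷ 2F ∷ 3F ∷ 4F ∷ 5F ∷ [])) e
  ... | no _ | yes e | _ =
    claw-of-repeated-colour c-sym gallai (distinct (0F ∷ 1F ∷ 3F ∷ 2F ∷ 4F ∷ 5F ∷ [])) e
  ... | no _ | no _ | yes e =
    claw-of-repeated-colour c-sym gallai (distinct (0F ∷ 2F ∷ 3F ∷ 1F ∷ 4F ∷ 5F ∷ [])) e
  ... | no n₁₂ | no n₁₃ | no n₂₃ =
    claw-of-distinct-colours c-sym gallai (distinct (0F ∷ 1F ∷ 2F ∷ 3F ∷ [])) n₁₂ n₁₃ n₂₃

  star-of-double-exception : ∀ {w y₁ y₂ i j} → Unique (w ∷ y₁ ∷ y₂ ∷ []) →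
    (∀ a → All (a ≢_) (w ∷ y₁ ∷ y₂ ∷ []) → c w a ≡ i) →
    c w y₁ ≡ j → c y₁ y₂ ≡ j → j ≢ i → MonoStar c
  star-of-double-exception {w} {y₁} {y₂} {i} {j}
    ((w≢y₁ ∷ w≢y₂ ∷ []) ∷ (y₁≢y₂ ∷ []) ∷ [] ∷ []) star wy₁≡j y₁y₂≡j j≢i = y₁-or-neighbour-star
    where
    y₁-spoke : ∀ z → z ≢ y₁ → c y₁ z ≡ j ⊎ (z ≢ w × z ≢ y₂ × c y₁ z ≡ i)
    y₁-spoke z z≢y₁ with z ≟ w | z ≟ y₂
    ... | yes refl | _ = inj₁ (trans (c-sym y₁ w) wy₁≡j)
    ... | no _ | yes refl = inj₁ y₁y₂≡j
    ... | no z≢w | no z≢y₂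
      with third-colour gallai w≢y₁ (≢-sym z≢y₁) (≢-sym z≢w) wy₁≡j (star z (z≢w ∷ z≢y₁ ∷ z≢y₂ ∷ [])) j≢i
    ...   | inj₁ y₁z≡j = inj₁ y₁z≡j
    ...   | inj₂ y₁z≡i = inj₂ (z≢w , z≢y₂ , y₁z≡i)

    y₁-or-neighbour-star : MonoStar c
    y₁-or-neighbour-star
      with any? (λ x → ¬? (x ≟ w) ×-dec ¬? (x ≟ y₁) ×-dec ¬? (x ≟ y₂) ×-dec (c y₁ x ≟ i))
    ... | no ¬i-edge = y₁ , j , y₁-star
      where
      y₁-star : ∀ z → z ≢ y₁ → c y₁ z ≡ j
      y₁-star z z≢y₁ with y₁-spoke z z≢y₁
      ... | inj₁ y₁z≡j = y₁z≡j
      ... | inj₂ (z≢w , z≢y₂ , y₁z≡i) = contradiction (z , z≢w , z≢y₁ , z≢y₂ , y₁z≡i) ¬i-edge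
    ... | yes (x , x≢w , x≢y₁ , x≢y₂ , y₁x≡i) = monoStar-of-starExcept x≢y₁ y₁-starExcept
      where
      y₁-starExcept : StarExcept y₁ x j
      y₁-starExcept a a≢y₁ a≢x with y₁-spoke a a≢y₁
      ... | inj₁ y₁a≡j = y₁a≡j
      ... | inj₂ (a≢w , a≢y₂ , y₁a≡i) =
        ⊥-elim (c4-free w x y₁ a i (≢-sym x≢w) w≢y₁ (≢-sym a≢w) x≢y₁ (≢-sym a≢x) (≢-sym a≢y₁)
                  (star x (x≢w ∷ x≢y₁ ∷ x≢y₂ ∷ [])) (trans (c-sym x y₁) y₁x≡i) y₁a≡i
                  (trans (c-sym a w) (star a (a≢w ∷ a≢y₁ ∷ a≢y₂ ∷ []))))

  module TwoExceptions {w a₁ a₂ a₃ y₁ y₂ i}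
    (w≢a₁ : w ≢ a₁) (w≢a₂ : w ≢ a₂) (w≢a₃ : w ≢ a₃) (a₁≢a₂ : a₁ ≢ a₂) (a₁≢a₃ : a₁ ≢ a₃) (a₂≢a₃ : a₂ ≢ a₃)
    (wa₁≡i : c w a₁ ≡ i) (wa₂≡i : c w a₂ ≡ i) (wa₃≡i : c w a₃ ≡ i)
    (y₁≢w : y₁ ≢ w) (y₂≢w : y₂ ≢ w) (y₂≢y₁ : y₂ ≢ y₁) (wy₁≢i : c w y₁ ≢ i) (wy₂≢i : c w y₂ ≢ i) where

    -- w, a₁, a₂, a₃, y₁, y₂ already exhaust the six vertices
    other-spokes : ∀ a → All (a ≢_) (w ∷ y₁ ∷ y₂ ∷ []) → c w a ≡ i
    other-spokes a (a≢w ∷ a≢y₁ ∷ a≢y₂ ∷ []) = decidable-stable (c w a ≟ i) λ wa≢i →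
      1+n≰n (unique-length≤ (
        (w≢a₁ ∷ w≢a₂ ∷ w≢a₃ ∷ ≢-sym y₁≢w ∷ ≢-sym y₂≢w ∷ ≢-sym a≢w ∷ []) ∷
        (a₁≢a₂ ∷ a₁≢a₃ ∷ a₁≢ wy₁≢i ∷ a₁≢ wy₂≢i ∷ a₁≢ wa≢i ∷ []) ∷
        (a₂≢a₃ ∷ a₂≢ wy₁≢i ∷ a₂≢ wy₂≢i ∷ a₂≢ wa≢i ∷ []) ∷
        (a₃≢ wy₁≢i ∷ a₃≢ wy₂≢i ∷ a₃≢ wa≢i ∷ []) ∷
        (≢-sym y₂≢y₁ ∷ ≢-sym a≢y₁ ∷ []) ∷
        (≢-sym a≢y₂ ∷ []) ∷ [] ∷ []))
      where
      a₁≢ : ∀ {y} → c w y ≢ i → a₁ ≢ y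
      a₁≢ = ≢-of-colours {c = c} wa₁≡i
      a₂≢ : ∀ {y} → c w y ≢ i → a₂ ≢ y
      a₂≢ = ≢-of-colours {c = c} wa₂≡i
      a₃≢ : ∀ {y} → c w y ≢ i → a₃ ≢ y
      a₃≢ = ≢-of-colours {c = c} wa₃≡i

    colour-at : ∀ {y a} → y ≢ w → c w y ≢ i → c w a ≡ i → w ≢ a → c a y ≡ i ⊎ c a y ≡ c w y
    colour-at y≢w wy≢i wa≡i w≢a =
      third-colour gallai w≢a (≢-of-colours {c = c} wa≡i wy≢i) (≢-sym y≢w) wa≡i refl (≢-sym wy≢i)

    i-cycle : ∀ {a a′ y} → c w a ≡ i → c w a′ ≡ i → w ≢ a → w ≢ a′ → a ≢ a′ → c w y ≢ i → y ≢ w →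
              c a y ≡ i → c a′ y ≡ i → ⊥
    i-cycle {a} {a′} {y} wa≡i wa′≡i w≢a w≢a′ a≢a′ wy≢i y≢w ay≡i a′y≡i =
      c4-free w a y a′ i w≢a (≢-sym y≢w) w≢a′ (≢-of-colours {c = c} wa≡i wy≢i) a≢a′
        (≢-sym (≢-of-colours {c = c} wa′≡i wy≢i)) wa≡i ay≡i (trans (c-sym y a′) a′y≡i) (trans (c-sym a′ w) wa′≡i)

    exceptions-differ : c w y₁ ≢ c w y₂
    exceptions-differ wy₁≡wy₂ =
      pigeonhole-3→2 (y₁-colour wa₁≡i w≢a₁) (y₁-colour wa₂≡i w≢a₂) (y₁-colour wa₃≡i w≢a₃)
        (leaves-differ wa₁≡i wa₂≡i w≢a₁ w≢a₂ a₁≢a₂) (leaves-differ wa₁≡i wa₃≡i w≢a₁ w≢a₃ a₁≢a₃)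
        (leaves-differ wa₂≡i wa₃≡i w≢a₂ w≢a₃ a₂≢a₃)
      where
      j : Fin K
      j = c w y₁
      y₁-colour : ∀ {a} → c w a ≡ i → w ≢ a → c a y₁ ≡ i ⊎ c a y₁ ≡ j
      y₁-colour = colour-at y₁≢w wy₁≢i
      -- if a y₁ has colour j then a y₂ cannot, or w y₁ a y₂ is a j-coloured 4-cycle
      y₂-colour : ∀ {a} → c w a ≡ i → w ≢ a → c a y₁ ≡ j → c a y₂ ≡ i
      y₂-colour {a} wa≡i w≢a ay₁≡j with colour-at y₂≢w wy₂≢i wa≡i w≢a
      ... | inj₁ ay₂≡i = ay₂≡i
      ... | inj₂ ay₂≡wy₂ = ⊥-elim (c4-free w y₁ a y₂ j (≢-sym y₁≢w) w≢a (≢-sym y₂≢w)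
                             (≢-sym (≢-of-colours {c = c} wa≡i wy₁≢i)) (≢-sym y₂≢y₁)
                             (≢-of-colours {c = c} wa≡i wy₂≢i)
                             refl (trans (c-sym y₁ a) ay₁≡j) (trans ay₂≡wy₂ (sym wy₁≡wy₂))
                             (trans (c-sym y₂ w) (sym wy₁≡wy₂)))
      leaves-differ : ∀ {a a′} → c w a ≡ i → c w a′ ≡ i → w ≢ a → w ≢ a′ → a ≢ a′ → c a y₁ ≢ c a′ y₁
      leaves-differ wa≡i wa′≡i w≢a w≢a′ a≢a′ ay₁≡a′y₁ with y₁-colour wa≡i w≢a
      ... | inj₁ ay₁≡i = i-cycle wa≡i wa′≡i w≢a w≢a′ a≢a′ wy₁≢i y₁≢w ay₁≡i (trans (sym ay₁≡a′y₁) ay₁≡i)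
      ... | inj₂ ay₁≡j = i-cycle wa≡i wa′≡i w≢a w≢a′ a≢a′ wy₂≢i y₂≢w
                           (y₂-colour wa≡i w≢a ay₁≡j) (y₂-colour wa′≡i w≢a′ (trans (sym ay₁≡a′y₁) ay₁≡j))

    monoStar : MonoStar c
    monoStar with third-colour gallai (≢-sym y₁≢w) (≢-sym y₂≢y₁) (≢-sym y₂≢w) refl refl exceptions-differ
    ... | inj₁ y₁y₂≡wy₁ =
      star-of-double-exception ((≢-sym y₁≢w ∷ ≢-sym y₂≢w ∷ []) ∷ (≢-sym y₂≢y₁ ∷ []) ∷ [] ∷ [])
        other-spokes refl y₁y₂≡wy₁ wy₁≢i
    ... | inj₂ y₁y₂≡wy₂ =
      star-of-double-exception ((≢-sym y₂≢w ∷ ≢-sym y₁≢w ∷ []) ∷ (y₂≢y₁ ∷ []) ∷ [] ∷ [])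
        (λ { a (a≢w ∷ a≢y₂ ∷ a≢y₁ ∷ []) → other-spokes a (a≢w ∷ a≢y₁ ∷ a≢y₂ ∷ []) })
        refl (trans (c-sym y₂ y₁) y₁y₂≡wy₂) wy₂≢i

  star-of-claw : MonoClaw c → MonoStar c
  star-of-claw (w , a₁ , a₂ , a₃ , i ,
      ((w≢a₁ ∷ w≢a₂ ∷ w≢a₃ ∷ []) ∷ (a₁≢a₂ ∷ a₁≢a₃ ∷ []) ∷ (a₂≢a₃ ∷ []) ∷ [] ∷ []) , wa₁≡i , wa₂≡i , wa₃≡i)
    with any? (λ y → ¬? (y ≟ w) ×-dec ¬? (c w y ≟ i))
  ... | no ¬exception = w , i , λ y y≢w → decidable-stable (c w y ≟ i) λ wy≢i → ¬exception (y , y≢w , wy≢i)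
  ... | yes (y₁ , y₁≢w , wy₁≢i) with any? (λ y → ¬? (y ≟ w) ×-dec ¬? (y ≟ y₁) ×-dec ¬? (c w y ≟ i))
  ... | no ¬exception = monoStar-of-starExcept y₁≢w λ y y≢w y≢y₁ →
          decidable-stable (c w y ≟ i) λ wy≢i → ¬exception (y , y≢w , y≢y₁ , wy≢i)
  ... | yes (y₂ , y₂≢w , y₂≢y₁ , wy₂≢i) =
    TwoExceptions.monoStar w≢a₁ w≢a₂ w≢a₃ a₁≢a₂ a₁≢a₃ a₂≢a₃ wa₁≡i wa₂≡i wa₃≡i y₁≢w y₂≢w y₂≢y₁ wy₁≢i wy₂≢i

monoStar : ∀ d {K} (c : Fin (6 + d) → Fin (6 + d) → Fin K) → (∀ x y → c x y ≡ c y x) →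
           Gallai c → C4Free c → MonoStar c
monoStar zero c c-sym gallai c4-free = K6.star-of-claw c c-sym gallai c4-free (K6.claw c c-sym gallai c4-free)
monoStar (suc d) c c-sym gallai c4-free
  with monoStar d (λ x y → c (suc x) (suc y)) (λ x y → c-sym (suc x) (suc y))
         (gallai-∘ suc-injective gallai) (c4Free-∘ suc-injective c4-free)
... | v , i , v-star = MonoStars.monoStar-of-starExcept c c-sym gallai c4-free (λ ()) star-except-zero
  where
  star-except-zero : ∀ w → w ≢ suc v → w ≢ zero → c (suc v) w ≡ i
  star-except-zero zero    _      0≢0 = contradiction refl 0≢0
  star-except-zero (suc w) w≢v _      = v-star w (w≢v ∘ cong suc)

-- Few colours force few vertices

ZeroMatching : ∀ {N k} → (Fin N → Fin N → Fin (suc k)) → Set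
ZeroMatching {N} c = ∀ {x y z : Fin N} → x ≢ y → x ≢ z → y ≢ z → c x y ≡ zero → c x z ≡ zero → ⊥

merge : ∀ {k} → Fin (suc k) → Fin (suc (suc k)) → Fin (suc k)
merge i x with suc i ≟ x
... | yes _    = zero
... | no 1+i≢x = punchOut 1+i≢x

merge-zero : ∀ {k} (i : Fin (suc k)) x → merge i x ≡ zero → x ≡ zero ⊎ x ≡ suc i
merge-zero i x merge≡0 with suc i ≟ x
merge-zero i x       _  | yes refl = inj₂ refl
merge-zero i zero    _  | no _     = inj₁ refl
merge-zero i (suc x) () | no _

merge-injective : ∀ {k} (i : Fin (suc k)) {x y} → merge i x ≡ merge i y → merge i x ≢ zero → x ≡ y
merge-injective i {x} {y} eq nonzero with suc i ≟ x | suc i ≟ y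
... | yes _      | _          = contradiction refl nonzero
... | no _       | yes _      = contradiction eq nonzero
... | no 1+i≢x   | no 1+i≢y   = punchOut-injective 1+i≢x 1+i≢y eq

module DeleteStar {n k} (c : Fin (suc n) → Fin (suc n) → Fin (suc (suc k))) (c-sym : ∀ x y → c x y ≡ c y x)
  (gallai : Gallai c) (c4-free : C4Free c) (matching : ZeroMatching c)
  {v : Fin (suc n)} {i : Fin (suc k)} (star : ∀ w → w ≢ v → c v w ≡ suc i) where

  no-mixed-corner : ∀ {x y z} → x ≢ v → y ≢ v → z ≢ v → x ≢ y → x ≢ z → y ≢ z →
                    c x y ≡ zero → c x z ≡ suc i → ⊥
  no-mixed-corner {x} {y} {z} x≢v y≢v z≢v x≢y x≢z y≢z xy≡0 xz≡1+i
    with third-colour gallai x≢y y≢z x≢z xy≡0 xz≡1+i (λ ())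
  ... | inj₁ yz≡0   = matching (≢-sym x≢y) y≢z x≢z (trans (c-sym y x) xy≡0) yz≡0
  ... | inj₂ yz≡1+i = c4-free v y z x (suc i) (≢-sym y≢v) (≢-sym z≢v) (≢-sym x≢v) y≢z (≢-sym x≢y) (≢-sym x≢z)
                        (star y y≢v) yz≡1+i (trans (c-sym z x) xz≡1+i) (trans (c-sym x v) (star x x≢v))

  private
    ι : Fin n → Fin (suc n)
    ι = punchIn v
    ι-≢ : ∀ {x y} → x ≢ y → ι x ≢ ι y
    ι-≢ {x} {y} x≢y = x≢y ∘ punchIn-injective v x y
    ι≢v : ∀ x → ι x ≢ v
    ι≢v = punchInᵢ≢i v

  c′ : Fin n → Fin n → Fin (suc k)
  c′ x y = merge i (c (ι x) (ι y))

  c′-sym : ∀ x y → c′ x y ≡ c′ y x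
  c′-sym x y = cong (merge i) (c-sym (ι x) (ι y))

  c′-gallai : Gallai c′
  c′-gallai = gallai-map (merge i) (gallai-∘ (λ {x} {y} → punchIn-injective v x y) gallai)

  c′-matching : ZeroMatching c′
  c′-matching {x} {y} {z} x≢y x≢z y≢z xy≡0 xz≡0 with merge-zero i _ xy≡0 | merge-zero i _ xz≡0
  ... | inj₁ xy≡0′  | inj₁ xz≡0′  = matching (ι-≢ x≢y) (ι-≢ x≢z) (ι-≢ y≢z) xy≡0′ xz≡0′
  ... | inj₁ xy≡0′  | inj₂ xz≡1+i =
    no-mixed-corner (ι≢v x) (ι≢v y) (ι≢v z) (ι-≢ x≢y) (ι-≢ x≢z) (ι-≢ y≢z) xy≡0′ xz≡1+i
  ... | inj₂ xy≡1+i | inj₁ xz≡0′  =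
    no-mixed-corner (ι≢v x) (ι≢v z) (ι≢v y) (ι-≢ x≢z) (ι-≢ x≢y) (ι-≢ (≢-sym y≢z)) xz≡0′ xy≡1+i
  ... | inj₂ xy≡1+i | inj₂ xz≡1+i =
    c4-free v (ι y) (ι x) (ι z) (suc i) (≢-sym (ι≢v y)) (≢-sym (ι≢v x)) (≢-sym (ι≢v z))
      (ι-≢ (≢-sym x≢y)) (ι-≢ y≢z) (ι-≢ x≢z)
      (star (ι y) (ι≢v y)) (trans (c-sym (ι y) (ι x)) xy≡1+i) xz≡1+i (trans (c-sym (ι z) v) (star (ι z) (ι≢v z)))

  c′-c4Free : C4Free c′
  c′-c4Free a b d e γ a≢b a≢d a≢e b≢d b≢e d≢e ab≡γ bd≡γ de≡γ ea≡γ with γ ≟ zero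
  ... | yes refl = c′-matching (≢-sym a≢b) b≢d a≢d (trans (c′-sym b a) ab≡γ) bd≡γ
  ... | no γ≢0 = c4-free (ι a) (ι b) (ι d) (ι e) (c (ι a) (ι b))
                   (ι-≢ a≢b) (ι-≢ a≢d) (ι-≢ a≢e) (ι-≢ b≢d) (ι-≢ b≢e) (ι-≢ d≢e)
                   refl (same-as-ab bd≡γ) (same-as-ab de≡γ) (same-as-ab ea≡γ)
    where
    same-as-ab : ∀ {x y} → c′ x y ≡ γ → c (ι x) (ι y) ≡ c (ι a) (ι b)
    same-as-ab xy≡γ = merge-injective i (trans xy≡γ (sym ab≡γ)) λ xy≡0 → γ≢0 (trans (sym xy≡γ) xy≡0)

module _ {m} {c : Fin (4 + m) → Fin (4 + m) → Fin 2} (c-sym : ∀ x y → c x y ≡ c y x) (c4-free : C4Free c)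
         (matching : ZeroMatching c) where

  private
    one-of-nonzero : ∀ {x y} → c x y ≢ zero → c x y ≡ suc zero
    one-of-nonzero {x} {y} xy≢0 with c x y
    ... | zero        = contradiction refl xy≢0
    ... | suc zero    = refl

  -- the zero edge p q makes the 4-cycle p r q s, all of whose edges touch it, entirely of colour 1
  no-zero-edge : ∀ {p q r s} → Unique (p ∷ q ∷ r ∷ s ∷ []) → c p q ≢ zero
  no-zero-edge {p} {q} {r} {s} ((p≢q ∷ p≢r ∷ p≢s ∷ []) ∷ (q≢r ∷ q≢s ∷ []) ∷ (r≢s ∷ []) ∷ [] ∷ []) pq≡0 =
    c4-free p r q s (suc zero) p≢r p≢q p≢s (≢-sym q≢r) r≢s q≢s
      (one-of-nonzero (matching p≢q p≢r q≢r pq≡0))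
      (one-of-nonzero λ rq≡0 → matching (≢-sym p≢q) q≢r p≢r qp≡0 (trans (c-sym q r) rq≡0))
      (one-of-nonzero (matching (≢-sym p≢q) q≢s p≢s qp≡0))
      (one-of-nonzero λ sp≡0 → matching p≢q p≢s q≢s pq≡0 (trans (c-sym p s) sp≡0))
    where
    qp≡0 : c q p ≡ zero
    qp≡0 = trans (c-sym q p) pq≡0

  two-colour-K4 : ⊥
  two-colour-K4 =
    c4-free 0F 1F 2F 3F (suc zero) (λ ()) (λ ()) (λ ()) (λ ()) (λ ()) (λ ())
      (colour-one (distinct (0F ∷ 1F ∷ 2F ∷ 3F ∷ []))) (colour-one (distinct (1F ∷ 2F ∷ 0F ∷ 3F ∷ [])))
      (colour-one (distinct (2F ∷ 3F ∷ 0F ∷ 1F ∷ []))) (colour-one (distinct (3F ∷ 0F ∷ 1F ∷ 2F ∷ [])))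
    where
    colour-one : ∀ {p q r s} → Unique (p ∷ q ∷ r ∷ s ∷ []) → c p q ≡ suc zero
    colour-one = one-of-nonzero ∘ no-zero-edge

VertexBound : ℕ → Set
VertexBound k = ∀ {n} (c : Fin n → Fin n → Fin (suc k)) → (∀ x y → c x y ≡ c y x) →
                Gallai c → C4Free c → ZeroMatching c → 3 + k < n → ⊥

vertex-bound-step : ∀ {k} → VertexBound (suc k) → VertexBound (suc (suc k))
vertex-bound-step ih c c-sym gallai c4-free matching (s≤s 4+k<n@(s≤s (s≤s (s≤s (s≤s (s≤s _))))))
  with monoStar _ c c-sym gallai c4-free
... | v , suc i , star = ih c′ c′-sym c′-gallai c′-c4Free c′-matching 4+k<n
  where open DeleteStar c c-sym gallai c4-free matching star
... | v , zero , star with fresh (v ∷ [])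
... | y , (y≢v ∷ []) with fresh (v ∷ y ∷ [])
... | z , (z≢v ∷ z≢y ∷ []) = matching (≢-sym y≢v) (≢-sym z≢v) (≢-sym z≢y) (star y y≢v) (star z z≢v)

vertex-bound : ∀ k → VertexBound k
vertex-bound zero c c-sym gallai c4-free matching (s≤s (s≤s (s≤s (s≤s _)))) =
  matching {0F} {1F} {2F} (λ ()) (λ ()) (λ ()) (only-zero _) (only-zero _)
  where
  only-zero : (x : Fin 1) → x ≡ zero
  only-zero zero = refl
vertex-bound (suc zero) c c-sym gallai c4-free matching (s≤s (s≤s (s≤s (s≤s (s≤s _))))) =
  two-colour-K4 c-sym c4-free matching
vertex-bound (suc (suc k)) = vertex-bound-step (vertex-bound (suc k))

-- The upper bound

module _ {k N} {E : Fin N → Fin N → Set} (E? : ∀ x y → Dec (E x y)) (c : Fin N → Fin N → Fin k) where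

  rainbowK3? : Dec (RainbowK3 E c)
  rainbowK3? = any? λ x → any? λ y → any? λ z →
    E? x y ×-dec E? y z ×-dec E? x z ×-dec
    ¬? (c x y ≟ c y z) ×-dec ¬? (c y z ≟ c x z) ×-dec ¬? (c x y ≟ c x z)

  monoC4? : Dec (MonoC4 E c)
  monoC4? = any? λ a → any? λ b → any? λ d → any? λ e →
    ¬? (a ≟ b) ×-dec ¬? (a ≟ d) ×-dec ¬? (a ≟ e) ×-dec ¬? (b ≟ d) ×-dec ¬? (b ≟ e) ×-dec ¬? (d ≟ e) ×-dec
    E? a b ×-dec E? b d ×-dec E? d e ×-dec E? e a ×-dec
    any? λ i → (c a b ≟ i) ×-dec (c b d ≟ i) ×-dec (c d e ≟ i) ×-dec (c e a ≟ i)

module _ {k N} {E E′ : Fin N → Fin N → Set} (E⇒E′ : ∀ {x y} → E x y → E′ x y) {c : Fin N → Fin N → Fin k} where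

  rainbowK3-mono : RainbowK3 E c → RainbowK3 E′ c
  rainbowK3-mono (x , y , z , xy , yz , xz , rainbow) = x , y , z , E⇒E′ xy , E⇒E′ yz , E⇒E′ xz , rainbow

  monoC4-mono : MonoC4 E c → MonoC4 E′ c
  monoC4-mono (a , b , d , e , a≢b , a≢d , a≢e , b≢d , b≢e , d≢e , ab , bd , de , ea , mono) =
    a , b , d , e , a≢b , a≢d , a≢e , b≢d , b≢e , d≢e , E⇒E′ ab , E⇒E′ bd , E⇒E′ de , E⇒E′ ea , mono

module _ {k N} {c : Fin N → Fin N → Fin k} where

  gallai-of-¬rainbowK3 : ¬ RainbowK3 _≢_ c → Gallai c
  gallai-of-¬rainbowK3 ¬rainbow x y z x≢y y≢z x≢z with c x y ≟ c y z | c y z ≟ c x z | c x y ≟ c x z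
  ... | yes xy≡yz | _         | _         = inj₁ xy≡yz
  ... | no _      | yes yz≡xz | _         = inj₂ (inj₁ yz≡xz)
  ... | no _      | no _      | yes xy≡xz = inj₂ (inj₂ xy≡xz)
  ... | no xy≢yz  | no yz≢xz  | no xy≢xz  =
    contradiction (x , y , z , x≢y , y≢z , x≢z , xy≢yz , yz≢xz , xy≢xz) ¬rainbow

  c4Free-of-¬monoC4 : ¬ MonoC4 _≢_ c → C4Free c
  c4Free-of-¬monoC4 ¬mono a b d e i a≢b a≢d a≢e b≢d b≢e d≢e ab≡i bd≡i de≡i ea≡i =
    ¬mono (a , b , d , e , a≢b , a≢d , a≢e , b≢d , b≢e , d≢e , a≢b , b≢d , d≢e , ≢-sym a≢e ,
           i , ab≡i , bd≡i , de≡i , ea≡i)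

c4Free-map : ∀ {N K K′} {c : Fin N → Fin N → Fin K} {f : Fin K → Fin K′} → Injective _≡_ _≡_ f →
             C4Free c → C4Free (λ x y → f (c x y))
c4Free-map {c = c} {f} f-injective c4-free a b d e γ a≢b a≢d a≢e b≢d b≢e d≢e ab≡γ bd≡γ de≡γ ea≡γ =
  c4-free a b d e (c a b) a≢b a≢d a≢e b≢d b≢e d≢e refl (as-ab bd≡γ) (as-ab de≡γ) (as-ab ea≡γ)
  where
  as-ab : ∀ {x y} → f (c x y) ≡ γ → c x y ≡ c a b
  as-ab xy≡γ = f-injective (trans xy≡γ (sym ab≡γ))

gallai-ramsey-C4 : ∀ k (c : Fin (suc (k + 3)) → Fin (suc (k + 3)) → Fin k) → (∀ x y → c x y ≡ c y x) →
                   RainbowK3 _≢_ c ⊎ MonoC4 _≢_ c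
gallai-ramsey-C4 k c c-sym with rainbowK3? (λ x y → ¬? (x ≟ y)) c | monoC4? (λ x y → ¬? (x ≟ y)) c
... | yes rainbow | _        = inj₁ rainbow
... | no _        | yes mono = inj₂ mono
... | no ¬rainbow | no ¬mono =
  -- shifting the colours up leaves colour zero unused, so trivially a matching
  ⊥-elim (vertex-bound k (λ x y → suc (c x y)) (λ x y → cong suc (c-sym x y))
            (gallai-map suc (gallai-of-¬rainbowK3 ¬rainbow)) (c4Free-map suc-injective (c4Free-of-¬monoC4 ¬mono))
            (λ _ _ _ ()) (s≤s (≤-reflexive (+-comm 3 k))))

starGood-complete : ∀ k → StarGood k (k + 3) (k + 3)
starGood-complete k S ∣S∣≡k+3 (c , c-sym) =
  Sum.map (rainbowK3-mono edge) (monoC4-mono edge) (gallai-ramsey-C4 k c c-sym)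
  where
  edge : ∀ {x y} → x ≢ y → Edge S x y
  edge {x} {y} x≢y = subst (λ T → Edge T x y) (sym (∣p∣≡n⇒p≡⊤ ∣S∣≡k+3)) (edge-⊤ x y x≢y)
    where
    edge-⊤ : ∀ x y → x ≢ y → Edge ⊤ x y
    edge-⊤ zero    zero    0≢0  = 0≢0 refl
    edge-⊤ zero    (suc j) _    = ∈⊤
    edge-⊤ (suc i) zero    _    = ∈⊤
    edge-⊤ (suc i) (suc j) i≢j  = i≢j ∘ cong suc

-- The lower bound

-- colour 1 is the 6-cycle 0 2 5 1 4 3 with the chord 4 5; colour 0 is the rest
core : Fin 6 → Fin 6 → Fin 2
core x y = Vec.lookup (Vec.lookup rows x) y
  where
  rows : Vec (Vec (Fin 2) 6) 6
  rows = (0F ∷ 0F ∷ 1F ∷ 1F ∷ 0F ∷ 0F ∷ []) ∷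
         (0F ∷ 0F ∷ 0F ∷ 0F ∷ 1F ∷ 1F ∷ []) ∷
         (1F ∷ 0F ∷ 0F ∷ 0F ∷ 0F ∷ 1F ∷ []) ∷
         (1F ∷ 0F ∷ 0F ∷ 0F ∷ 1F ∷ 0F ∷ []) ∷
         (0F ∷ 1F ∷ 0F ∷ 1F ∷ 0F ∷ 1F ∷ []) ∷
         (0F ∷ 1F ∷ 1F ∷ 0F ∷ 1F ∷ 0F ∷ []) ∷ []

core-sym : ∀ x y → core x y ≡ core y x
core-sym = from-yes (all? λ x → all? λ y → core x y ≟ core y x)

edge? : ∀ {m} (S : Subset m) x y → Dec (Edge S x y)
edge? S zero    zero    = no λ ()
edge? S zero    (suc j) = j ∈? S
edge? S (suc i) zero    = i ∈? S
edge? S (suc i) (suc j) = ¬? (i ≟ j)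

-- core is a 2-colouring of K₅ ⊔ K₁,₄ (vertex 0 not joined to vertex 1)
core-noMonoC4 : ¬ MonoC4 (Edge (outside ∷ ⊤)) core
core-noMonoC4 = from-no (monoC4? (edge? (outside ∷ ⊤)) core)

min : ∀ {n} → Fin n → Fin n → Fin n
min zero    _       = zero
min (suc _) zero    = zero
min (suc s) (suc t) = suc (min s t)

min-sel : ∀ {n} (s t : Fin n) → min s t ≡ s ⊎ min s t ≡ t
min-sel zero    _       = inj₁ refl
min-sel (suc _) zero    = inj₂ refl
min-sel (suc s) (suc t) = Sum.map (cong suc) (cong suc) (min-sel s t)

min-comm : ∀ {n} (s t : Fin n) → min s t ≡ min t s
min-comm zero    zero    = refl
min-comm zero    (suc _) = refl
min-comm (suc _) zero    = refl
min-comm (suc s) (suc t) = cong suc (min-comm s t)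

min-repeats : ∀ {n} (s t u : Fin n) → min s t ≡ min t u ⊎ min t u ≡ min s u ⊎ min s t ≡ min s u
min-repeats zero    _       _       = inj₂ (inj₂ refl)
min-repeats (suc _) zero    _       = inj₁ refl
min-repeats (suc _) (suc _) zero    = inj₂ (inj₁ refl)
min-repeats (suc s) (suc t) (suc u) = Sum.map (cong suc) (Sum.map (cong suc) (cong suc)) (min-repeats s t u)

two-colours-repeat : ∀ (x y z : Fin 2) → x ≡ y ⊎ y ≡ z ⊎ x ≡ z
two-colours-repeat 0F 0F _  = inj₁ refl
two-colours-repeat 1F 1F _  = inj₁ refl
two-colours-repeat 0F 1F 0F = inj₂ (inj₂ refl)
two-colours-repeat 0F 1F 1F = inj₂ (inj₁ refl)
two-colours-repeat 1F 0F 0F = inj₂ (inj₁ refl)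
two-colours-repeat 1F 0F 1F = inj₂ (inj₂ refl)

-- the core, plus k′ extra vertices each of which sends its own colour to all later vertices
Kind : ℕ → Set
Kind k′ = Fin 6 ⊎ Fin k′

blowUp : ∀ {k′} → Kind k′ → Kind k′ → Fin 2 ⊎ Fin k′
blowUp (inj₁ x) (inj₁ y) = inj₁ (core x y)
blowUp (inj₁ _) (inj₂ t) = inj₂ t
blowUp (inj₂ s) (inj₁ _) = inj₂ s
blowUp (inj₂ s) (inj₂ t) = inj₂ (min s t)

blowUp-sym : ∀ {k′} (p q : Kind k′) → blowUp p q ≡ blowUp q p
blowUp-sym (inj₁ x) (inj₁ y) = cong inj₁ (core-sym x y)
blowUp-sym (inj₁ _) (inj₂ _) = refl
blowUp-sym (inj₂ _) (inj₁ _) = refl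
blowUp-sym (inj₂ s) (inj₂ t) = cong inj₂ (min-comm s t)

blowUp-gallai : ∀ {k′} (p q r : Kind k′) →
                blowUp p q ≡ blowUp q r ⊎ blowUp q r ≡ blowUp p r ⊎ blowUp p q ≡ blowUp p r
blowUp-gallai (inj₁ x) (inj₁ y) (inj₁ z) =
  Sum.map (cong inj₁) (Sum.map (cong inj₁) (cong inj₁)) (two-colours-repeat (core x y) (core y z) (core x z))
blowUp-gallai (inj₁ _) (inj₁ _) (inj₂ _) = inj₂ (inj₁ refl)
blowUp-gallai (inj₁ _) (inj₂ _) (inj₁ _) = inj₁ refl
blowUp-gallai (inj₂ _) (inj₁ _) (inj₁ _) = inj₂ (inj₂ refl)
blowUp-gallai (inj₁ _) (inj₂ s) (inj₂ t) =
  [ (λ e → inj₁ (cong inj₂ (sym e))) , (λ e → inj₂ (inj₁ (cong inj₂ e))) ]′ (min-sel s t)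
blowUp-gallai (inj₂ s) (inj₁ _) (inj₂ t) =
  [ (λ e → inj₂ (inj₂ (cong inj₂ (sym e)))) , (λ e → inj₂ (inj₁ (cong inj₂ (sym e)))) ]′ (min-sel s t)
blowUp-gallai (inj₂ s) (inj₂ t) (inj₁ _) =
  [ (λ e → inj₂ (inj₂ (cong inj₂ e))) , (λ e → inj₁ (cong inj₂ e)) ]′ (min-sel s t)
blowUp-gallai (inj₂ s) (inj₂ t) (inj₂ u) =
  Sum.map (cong inj₂) (Sum.map (cong inj₂) (cong inj₂)) (min-repeats s t u)

Linked : ∀ {k′} → Kind k′ → Kind k′ → Set
Linked p q = ¬ (p ≡ inj₁ 0F × q ≡ inj₁ 1F) × ¬ (p ≡ inj₁ 1F × q ≡ inj₁ 0F)

core-edge : ∀ {k′} {x y : Fin 6} → x ≢ y → Linked {k′} (inj₁ x) (inj₁ y) → Edge (outside ∷ ⊤) x y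
core-edge {x = 0F}    {0F}            0≢0 _          = 0≢0 refl
core-edge {x = 0F}    {1F}            _   (¬01 , _)  = ⊥-elim (¬01 (refl , refl))
core-edge {x = 0F}    {suc (suc _)}   _   _          = there ∈⊤
core-edge {x = 1F}    {0F}            _   (_ , ¬10)  = ⊥-elim (¬10 (refl , refl))
core-edge {x = suc (suc _)} {0F}      _   _          = there ∈⊤
core-edge {x = suc _} {suc _}         x≢y _          = x≢y ∘ cong suc

extra-coloured : ∀ {k′} (p q : Kind k′) {t} → blowUp p q ≡ inj₂ t → p ≡ inj₂ t ⊎ q ≡ inj₂ t
extra-coloured (inj₁ _) (inj₂ _) refl = inj₂ refl
extra-coloured (inj₂ _) (inj₁ _) refl = inj₁ refl
extra-coloured (inj₂ s) (inj₂ t) refl = Sum.map (cong inj₂ ∘ sym) (cong inj₂ ∘ sym) (min-sel s t)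

blowUp-noMonoC4 : ∀ {k′} {a b d e : Kind k′} {γ} → Unique (a ∷ b ∷ d ∷ e ∷ []) →
  Linked a b → Linked b d → Linked d e → Linked e a →
  blowUp a b ≡ γ → blowUp b d ≡ γ → blowUp d e ≡ γ → blowUp e a ≡ γ → ⊥
blowUp-noMonoC4 {a = a} {b} {d} {e} {inj₂ t}
  ((a≢b ∷ a≢d ∷ a≢e ∷ []) ∷ (b≢d ∷ b≢e ∷ []) ∷ (d≢e ∷ []) ∷ [] ∷ []) _ _ _ _ ab≡t _ de≡t _
  with extra-coloured a b ab≡t | extra-coloured d e de≡t
... | inj₁ refl | inj₁ refl = a≢d refl
... | inj₁ refl | inj₂ refl = a≢e refl
... | inj₂ refl | inj₁ refl = b≢d refl
... | inj₂ refl | inj₂ refl = b≢e refl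
blowUp-noMonoC4 {a = inj₁ x} {inj₁ y} {inj₁ z} {inj₁ w} {inj₁ β}
  ((a≢b ∷ a≢d ∷ a≢e ∷ []) ∷ (b≢d ∷ b≢e ∷ []) ∷ (d≢e ∷ []) ∷ [] ∷ []) ab bd de ea ab≡β bd≡β de≡β ea≡β =
  core-noMonoC4 (x , y , z , w , core-≢ a≢b , core-≢ a≢d , core-≢ a≢e , core-≢ b≢d , core-≢ b≢e , core-≢ d≢e ,
                 core-edge (core-≢ a≢b) ab , core-edge (core-≢ b≢d) bd , core-edge (core-≢ d≢e) de ,
                 core-edge (≢-sym (core-≢ a≢e)) ea ,
                 β , inj₁-injective ab≡β , inj₁-injective bd≡β , inj₁-injective de≡β , inj₁-injective ea≡β)
  where
  core-≢ : ∀ {u v : Fin 6} → inj₁ u ≢ inj₁ v → u ≢ v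
  core-≢ u≢v = u≢v ∘ cong inj₁
blowUp-noMonoC4 {a = inj₂ _} {inj₁ _} {γ = inj₁ _} _ _ _ _ _ () _ _ _
blowUp-noMonoC4 {a = inj₂ _} {inj₂ _} {γ = inj₁ _} _ _ _ _ _ () _ _ _
blowUp-noMonoC4 {a = inj₁ _} {inj₂ _} {γ = inj₁ _} _ _ _ _ _ () _ _ _
blowUp-noMonoC4 {a = inj₁ _} {inj₁ _} {inj₂ _} {γ = inj₁ _} _ _ _ _ _ _ () _ _
blowUp-noMonoC4 {a = inj₁ _} {inj₁ _} {inj₁ _} {inj₂ _} {inj₁ _} _ _ _ _ _ _ _ () _

join-injective : ∀ m n {u v : Fin m ⊎ Fin n} → join m n u ≡ join m n v → u ≡ v
join-injective m n {u} {v} eq = trans (sym (splitAt-join m n u)) (trans (cong (splitAt m) eq) (splitAt-join m n v))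

module _ {k′ : ℕ} where

  -- the vertices of K_{k′+5} ⊔ K₁,ₛ: the first three (the extra vertex 0 and its non-neighbour 1) go to
  -- core vertices 0, 1, 2, the remaining ones to the extra vertices followed by core vertices 3, 4, 5
  kind : Fin (3 + (k′ + 3)) → Kind k′
  kind 0F = inj₁ 0F
  kind 1F = inj₁ 1F
  kind 2F = inj₁ 2F
  kind (suc (suc (suc j))) = [ inj₂ , inj₁ ∘ (3 ↑ʳ_) ]′ (splitAt k′ j)

  vertex : Kind k′ → Fin (3 + (k′ + 3))
  vertex (inj₁ 0F)                  = 0F
  vertex (inj₁ 1F)                  = 1F
  vertex (inj₁ 2F)                  = 2F
  vertex (inj₁ (suc (suc (suc r)))) = suc (suc (suc (k′ ↑ʳ r)))
  vertex (inj₂ t)                   = suc (suc (suc (t ↑ˡ 3)))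

  vertex-kind : ∀ x → vertex (kind x) ≡ x
  vertex-kind 0F = refl
  vertex-kind 1F = refl
  vertex-kind 2F = refl
  vertex-kind (suc (suc (suc j))) with splitAt k′ j | join-splitAt k′ 3 j
  ... | inj₁ t | t↑ˡ3≡j = cong (3 ↑ʳ_) t↑ˡ3≡j
  ... | inj₂ r | k′↑ʳr≡j = cong (3 ↑ʳ_) k′↑ʳr≡j

  kind-≡ : ∀ {x p} → kind x ≡ p → x ≡ vertex p
  kind-≡ {x} refl = sym (vertex-kind x)

  kind-≢ : ∀ {x y} → x ≢ y → kind x ≢ kind y
  kind-≢ {x} {y} x≢y kx≡ky = x≢y (trans (kind-≡ kx≡ky) (vertex-kind y))

  linked : ∀ {S x y} → Edge (outside ∷ S) x y → Linked (kind x) (kind y)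
  linked {S} {x} {y} xy =
    (λ (x↦0 , y↦1) → no-edge-01 (subst₂ (Edge (outside ∷ S)) (kind-≡ x↦0) (kind-≡ y↦1) xy)) ,
    (λ (x↦1 , y↦0) → no-edge-10 (subst₂ (Edge (outside ∷ S)) (kind-≡ x↦1) (kind-≡ y↦0) xy))
    where
    no-edge-01 : ¬ Edge (outside ∷ S) 0F 1F
    no-edge-01 ()
    no-edge-10 : ¬ Edge (outside ∷ S) 1F 0F
    no-edge-10 ()

  colouring : Fin (3 + (k′ + 3)) → Fin (3 + (k′ + 3)) → Fin (2 + k′)
  colouring x y = join 2 k′ (blowUp (kind x) (kind y))

  colouring-sym : ∀ x y → colouring x y ≡ colouring y x
  colouring-sym x y = cong (join 2 k′) (blowUp-sym (kind x) (kind y))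

  colouring-noRainbowK3 : ∀ {S} → ¬ RainbowK3 (Edge S) colouring
  colouring-noRainbowK3 (x , y , z , _ , _ , _ , xy≢yz , yz≢xz , xy≢xz)
    with blowUp-gallai (kind x) (kind y) (kind z)
  ... | inj₁ xy≡yz        = xy≢yz (cong (join 2 k′) xy≡yz)
  ... | inj₂ (inj₁ yz≡xz) = yz≢xz (cong (join 2 k′) yz≡xz)
  ... | inj₂ (inj₂ xy≡xz) = xy≢xz (cong (join 2 k′) xy≡xz)

  colouring-noMonoC4 : ∀ {S} → ¬ MonoC4 (Edge (outside ∷ S)) colouring
  colouring-noMonoC4 (a , b , d , e , a≢b , a≢d , a≢e , b≢d , b≢e , d≢e , ab , bd , de , ea , γ ,
                      ab≡γ , bd≡γ , de≡γ , ea≡γ) =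
    blowUp-noMonoC4
      ((kind-≢ a≢b ∷ kind-≢ a≢d ∷ kind-≢ a≢e ∷ []) ∷ (kind-≢ b≢d ∷ kind-≢ b≢e ∷ []) ∷ (kind-≢ d≢e ∷ []) ∷ [] ∷ [])
      (linked ab) (linked bd) (linked de) (linked ea)
      refl (as-ab {b} {d} bd≡γ) (as-ab {d} {e} de≡γ) (as-ab {e} {a} ea≡γ)
    where
    as-ab : ∀ {x y} → colouring x y ≡ γ → blowUp (kind x) (kind y) ≡ blowUp (kind a) (kind b)
    as-ab xy≡γ = join-injective 2 k′ (trans xy≡γ (sym ab≡γ))

prefix : ∀ {n} → ℕ → Subset n
prefix {zero}  _       = []
prefix {suc n} zero    = outside ∷ prefix zero
prefix {suc n} (suc s) = inside ∷ prefix s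

∣prefix∣ : ∀ {n s} → s ≤ n → ∣ prefix {n} s ∣ ≡ s
∣prefix∣ {zero}  z≤n      = refl
∣prefix∣ {suc n} z≤n      = ∣prefix∣ {n} z≤n
∣prefix∣ (s≤s s≤n) = cong suc (∣prefix∣ s≤n)

¬starGood : ∀ k′ s → s < 2 + k′ + 3 → ¬ StarGood (2 + k′) (2 + k′ + 3) s
¬starGood k′ s (s≤s s≤k′+4) good
  with good (outside ∷ prefix s) (∣prefix∣ s≤k′+4) (colouring , colouring-sym)
... | inj₁ rainbow = colouring-noRainbowK3 rainbow
... | inj₂ mono    = colouring-noMonoC4 mono

theorem3p3 : (k : ℕ) → 2 ≤ k → StarCriticalGR-K3-C4 k (k + 3)
theorem3p3 (suc (suc k′)) _ = starGood-complete (2 + k′) , ¬starGood k′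
theorem3p3 (suc zero) (s≤s ())
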